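{- Let $R$ be a complete discrete valuation ring with maximal ideal $\mathfrak{p}=pR$, residue field $\mathbb{F}_q=R/\mathfrak{p}$, and field of fractions $F$. Fix $n\ge1$, $\gamma=\begin{pmatrix}0&1\\ p^n&0\end{pmatrix}$, $\mathcal{O}=\begin{pmatrix}R&R\\ \mathfrak{p}^n&R\end{pmatrix}$. For each $s\in R/\mathfrak{p}$ choose $b_s\in R$ representing $s$, set $\alpha_s=\begin{pmatrix}1&b_s\\0&p\end{pmatrix}$, $S_1=\{\mathcal{O}\alpha_s\}$, $S_2=\{\mathcal{O}\gamma^{ -1}\alpha_s\gamma\}$. Let $\omega\in\mathcal{O}^\times$ and let $\sigma_\omega(P)=P\omega$, which permutes each of $S_1$ and $S_2$. Suppose that for $i=1,2$, all cycles of $\sigma_\omega|_{S_i}$ of length greater than $1$ have a common length $\ell_i$, and that $\ell_1>1$ and $\ell_2>1$. If $q$ is prime (i.e. $q=\operatorname{char}(\mathbb{F}_q)$), or if $\operatorname{trd}(\omega)^2-4\operatorname{nrd}(\omega)\notin\mathfrak{p}$, then $\ell_1=\ell_2$.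
   Context: $\operatorname{nrd}=\det$ and $\operatorname{trd}=$ trace on $\operatorname{M}_2(F)$. (It is known that all non-trivial cycles of such permutations have a common length.) -}

module Defs where

open import Level using (Level; _⊔_)
open import Algebra.Bundles using (CommutativeRing)
open import Data.Nat using (ℕ; zero; suc; _≤_; _<_)
open import Data.Fin using (Fin)
open import Data.Product using (Σ; ∃; _×_; _,_)
open import Data.Sum using (_⊎_)
open import Relation.Nullary using (¬_)
open import Relation.Binary.PropositionalEquality using (_≡_)

module Over {c ℓ : Level} (R : CommutativeRing c ℓ) where
  open CommutativeRing R renaming (Carrier to A)

  pow : A → ℕ → A
  pow x zero    = 1#
  pow x (suc k) = x * pow x k

  IsUnit : A → Set (c ⊔ ℓ)
  IsUnit a = ∃ λ b → a * b ≈ 1#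

  _∣R_ : A → A → Set (c ⊔ ℓ)
  x ∣R y = ∃ λ r → y ≈ x * r

  -- R is a discrete valuation ring with uniformizer p (maximal ideal 𝔭 = p R):
  -- an integral domain, p is a non-unit, and every nonzero element is u * p^k, u a unit.
  record IsDVR (p : A) : Set (c ⊔ ℓ) where
    field
      one≉zero     : ¬ (1# ≈ 0#)
      noZeroDiv    : ∀ x y → x * y ≈ 0# → (x ≈ 0#) ⊎ (y ≈ 0#)
      p-nonunit    : ¬ IsUnit p
      factorise    : ∀ x → ¬ (x ≈ 0#) → Σ A λ u → Σ ℕ λ k → IsUnit u × (x ≈ u * pow p k)

  -- 𝔭-adic completeness: every 𝔭-adically Cauchy sequence converges.
  IsComplete : A → Set (c ⊔ ℓ)
  IsComplete p = (a : ℕ → A) → (∀ m → pow p m ∣R (a (suc m) - a m)) →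
                 Σ A λ L → ∀ m → pow p m ∣R (L - a m)

  -- b : Fin q → R is a complete set of representatives of R/𝔭 (so R/𝔭 ≅ F_q, q = |R/𝔭|).
  record IsResidueReps (p : A) (q : ℕ) (b : Fin q → A) : Set (c ⊔ ℓ) where
    field
      distinct : ∀ i j → p ∣R (b i - b j) → i ≡ j
      covers   : ∀ x → Σ (Fin q) λ i → p ∣R (x - b i)

  record M2 : Set c where
    constructor mat
    field
      m11 m12 m21 m22 : A
  open M2 public

  _≈M_ : M2 → M2 → Set ℓ
  X ≈M Y = (m11 X ≈ m11 Y) × (m12 X ≈ m12 Y) × (m21 X ≈ m21 Y) × (m22 X ≈ m22 Y)

  _⊗_ : M2 → M2 → M2
  X ⊗ Y = mat (m11 X * m11 Y + m12 X * m21 Y) (m11 X * m12 Y + m12 X * m22 Y)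
              (m21 X * m11 Y + m22 X * m21 Y) (m21 X * m12 Y + m22 X * m22 Y)

  I2 : M2
  I2 = mat 1# 0# 0# 1#

  mpow : M2 → ℕ → M2
  mpow X zero    = I2
  mpow X (suc k) = mpow X k ⊗ X

  trd nrd : M2 → A
  trd X = m11 X + m22 X
  nrd X = m11 X * m22 X - m12 X * m21 X

  -- the Eichler order 𝒪 = (R R ; 𝔭^n R)
  InO : A → ℕ → M2 → Set (c ⊔ ℓ)
  InO p n X = pow p n ∣R m21 X

  InOUnits : A → ℕ → M2 → Set (c ⊔ ℓ)
  InOUnits p n ω = InO p n ω × Σ M2 λ ω' → InO p n ω' × ((ω ⊗ ω') ≈M I2) × ((ω' ⊗ ω) ≈M I2)

  InCoset : A → ℕ → M2 → M2 → Set (c ⊔ ℓ)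
  InCoset p n X M = Σ M2 λ x → InO p n x × (M ≈M (x ⊗ X))

  SameCoset : A → ℕ → M2 → M2 → Set (c ⊔ ℓ)
  SameCoset p n X Y = ∀ M → (InCoset p n X M → InCoset p n Y M) × (InCoset p n Y M → InCoset p n X M)

  alpha : A → A → M2
  alpha p b = mat 1# b 0# p

  -- γ⁻¹ α_s γ with γ = (0 1 ; p^n 0), computed explicitly: (p 0 ; b p^n 1)
  alphaConj : A → ℕ → A → M2
  alphaConj p n b = mat p 0# (b * pow p n) 1#

  -- The coset 𝒪 X has cycle length k under σ_ω : P ↦ P ω
  -- (σ_ω^j (𝒪 X) = 𝒪 (X ω^j)).
  CycleLength : A → ℕ → M2 → M2 → ℕ → Set (c ⊔ ℓ)
  CycleLength p n ω X k =
    (1 ≤ k) × SameCoset p n (X ⊗ mpow ω k) X ×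
    (∀ j → 1 ≤ j → j < k → ¬ SameCoset p n (X ⊗ mpow ω j) X)

  CommonCycleLength : A → ℕ → M2 → (q : ℕ) → (Fin q → M2) → ℕ → Set (c ⊔ ℓ)
  CommonCycleLength p n ω q f l =
    (1 < l) × (Σ (Fin q) λ s → CycleLength p n ω (f s) l) ×
    (∀ s k → CycleLength p n ω (f s) k → 1 < k → k ≡ l)

module Submission where

-- Write ω = (a b ; c d) with c = pⁿ c₀.  By Cayley–Hamilton every power is a
-- linear polynomial in ω:  ωʲ = Tⱼ ω + Uⱼ I  for explicit Tⱼ, Uⱼ ∈ R.
-- On the other hand, since ωʲ is a unit of 𝒪, the coset 𝒪Xωʲ equals 𝒪X iff a
-- single congruence holds, and that congruence is R-linear in ωʲ:
--   𝒪αₛωʲ = 𝒪αₛ  iff  p ∣ Bⱼ + s(Dⱼ − Aⱼ) = Tⱼ · (b + s(d − a)),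
--   𝒪βₛωʲ = 𝒪βₛ  iff  p^(n+1) ∣ Cⱼ + s pⁿ (Aⱼ − Dⱼ) = pⁿ Tⱼ · (c₀ + s(a − d)).
-- A cycle of length ℓ > 1 means that the congruence fails for j = 1, so the
-- fixed factor (b + s(d − a), resp. c₀ + s(a − d)) is prime to p; as p is prime,
-- ℓ is then the least j ≥ 1 with p ∣ Tⱼ.  This number depends on ω alone, so
-- ℓ₁ = ℓ₂.

open import Defs
open import Level using (Level)
open import Algebra.Bundles using (CommutativeRing)
open import Data.Nat using (ℕ; _≤_)
open import Data.Nat.Primality using (Prime)
open import Data.Fin using (Fin)
open import Data.Sum using (_⊎_)
open import Relation.Nullary using (¬_)
open import Relation.Binary.PropositionalEquality using (_≡_)

open import Level using (_⊔_)
open import Algebra.Bundles using (RawRing)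
open import Algebra.Solver.Ring.AlmostCommutativeRing
  using (fromCommutativeRing; _-Raw-AlmostCommutative⟶_; Induced-equivalence)
import Tactic.RingSolver.Core.AlmostCommutativeRing as AlmostCommutativeRing′
open import Data.Nat as ℕ using (zero; suc; _<_)
open import Data.Nat.Properties using (_≟_; <-cmp; ≤-refl)
open import Data.Product using (Σ; _×_; _,_; proj₁; proj₂)
open import Data.Product.Properties using (≡-dec)
open import Data.Maybe using (just; nothing)
open import Data.Sum using (inj₁; inj₂)
open import Data.Empty using (⊥-elim)
open import Function.Bundles using (_⇔_; mk⇔; Equivalence)
open import Relation.Nullary using (yes; no)
open import Relation.Binary.Bundles using (Setoid)
open import Relation.Binary.Structures using (IsEquivalence)
open import Relation.Binary.Definitions using (WeaklyDecidable; tri<; tri≈; tri>)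
import Relation.Binary.PropositionalEquality as ≡
import Relation.Binary.Reasoning.Setoid

-- A ring solver for an arbitrary commutative ring R.  Its coefficients are the
-- integers, kept as normalised pairs (a , b) of naturals standing for a − b;
-- normalisation makes equal integers syntactically equal, so cancelling terms are
-- recognised (the library's generic instantiation, with coefficients in R itself,
-- cannot decide that a coefficient vanishes).  The pair (1 , 0) denotes 1# and
-- (0 , 0) denotes 0# definitionally, so identities may mention 1# and 0#.
module IntegerCoefficientSolver {c ℓ : Level} (R : CommutativeRing c ℓ) where
  open CommutativeRing R hiding (zero)
  open import Algebra.Properties.Semiring.Mult.TCOptimised semiring
    using (×-homo-+; ×1-homo-*; 1+×) renaming (_×_ to _·_)
  open import Algebra.Properties.Ring ring using (-0#≈0#; x[y-z]≈xy-xz; [y-z]x≈yx-zx)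
  open import Algebra.Properties.AbelianGroup +-abelianGroup using (⁻¹-∙-comm; ⁻¹-anti-homo‿-)
  open import Tactic.RingSolver.Core.Expression using (_⊕_)
  open import Tactic.RingSolver.NonReflective (AlmostCommutativeRing′.fromCommutativeRing R (λ _ → nothing))
    using () renaming (solve to rearrange; _⊜_ to _≐_)
  open import Relation.Binary.Reasoning.Setoid setoid

  Int : Set
  Int = ℕ × ℕ

  normalise : ℕ → ℕ → Int
  normalise (suc a) (suc b) = normalise a b
  normalise a       b       = a , b

  ι : ℕ → Carrier
  ι a = a · 1#

  ⟦_⟧ᶻ : Int → Carrier
  ⟦ a , zero  ⟧ᶻ = ι a
  ⟦ a , suc b ⟧ᶻ = ι a - ι (suc b)

  ⟦⟧ᶻ-difference : ∀ a b → ⟦ a , b ⟧ᶻ ≈ ι a - ι b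
  ⟦⟧ᶻ-difference a zero    = sym (trans (+-congˡ -0#≈0#) (+-identityʳ (ι a)))
  ⟦⟧ᶻ-difference a (suc b) = refl

  -- the abelian-group identities behind additivity and multiplicativity of ⟦_⟧ᶻ;
  -- swap-middle involves no cancellation, so R's own coefficients suffice for it
  swap-middle : ∀ w x y z → (w + x) + (y + z) ≈ (w + y) + (x + z)
  swap-middle = rearrange 4 (λ w x y z → ((w ⊕ x) ⊕ (y ⊕ z)) ≐ ((w ⊕ y) ⊕ (x ⊕ z))) refl

  difference-sum : ∀ x y z w → (x + z) - (y + w) ≈ (x - y) + (z - w)
  difference-sum x y z w = trans (+-congˡ (sym (⁻¹-∙-comm y w))) (swap-middle x z (- y) (- w))

  difference-product : ∀ x y z w → (x * z + y * w) - (x * w + y * z) ≈ (x - y) * (z - w)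
  difference-product x y z w = begin
    (x * z + y * w) - (x * w + y * z)   ≈⟨ difference-sum (x * z) (x * w) (y * w) (y * z) ⟩
    (x * z - x * w) + (y * w - y * z)   ≈⟨ +-congˡ (⁻¹-anti-homo‿- (y * z) (y * w)) ⟨
    (x * z - x * w) - (y * z - y * w)   ≈⟨ +-cong (x[y-z]≈xy-xz x z w) (-‿cong (x[y-z]≈xy-xz y z w)) ⟨
    x * (z - w) - y * (z - w)           ≈⟨ [y-z]x≈yx-zx (z - w) x y ⟨
    (x - y) * (z - w)                   ∎

  cancel-1 : ∀ x y → (1# + x) - (1# + y) ≈ x - y
  cancel-1 x y = begin
    (1# + x) - (1# + y)   ≈⟨ difference-sum 1# 1# x y ⟩
    (1# - 1#) + (x - y)   ≈⟨ +-congʳ (-‿inverseʳ 1#) ⟩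
    0# + (x - y)          ≈⟨ +-identityˡ _ ⟩
    x - y                 ∎

  normalise-sound : ∀ a b → ⟦ normalise a b ⟧ᶻ ≈ ι a - ι b
  normalise-sound (suc a) (suc b) = begin
    ⟦ normalise a b ⟧ᶻ        ≈⟨ normalise-sound a b ⟩
    ι a - ι b                 ≈⟨ cancel-1 (ι a) (ι b) ⟨
    (1# + ι a) - (1# + ι b)   ≈⟨ +-cong (1+× a 1#) (-‿cong (1+× b 1#)) ⟨
    ι (suc a) - ι (suc b)     ∎
  normalise-sound zero    b    = ⟦⟧ᶻ-difference zero b
  normalise-sound (suc a) zero = ⟦⟧ᶻ-difference (suc a) zero

  ℤ-rawRing : RawRing _ _
  ℤ-rawRing = record
    { Carrier = Int
    ; _≈_     = _≡_
    ; _+_     = λ { (a , b) (c , d) → normalise (a ℕ.+ c) (b ℕ.+ d) }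
    ; _*_     = λ { (a , b) (c , d) → normalise (a ℕ.* c ℕ.+ b ℕ.* d) (a ℕ.* d ℕ.+ b ℕ.* c) }
    ; -_      = λ { (a , b) → b , a }
    ; 0#      = 0 , 0
    ; 1#      = 1 , 0
    }

  ⟦⟧ᶻ-homomorphism : ℤ-rawRing -Raw-AlmostCommutative⟶ fromCommutativeRing R
  ⟦⟧ᶻ-homomorphism = record
    { ⟦_⟧    = ⟦_⟧ᶻ
    ; +-homo = +-homo
    ; *-homo = *-homo
    ; -‿homo = λ { (a , b) → trans (⟦⟧ᶻ-difference b a)
                   (trans (sym (⁻¹-anti-homo‿- (ι a) (ι b))) (-‿cong (sym (⟦⟧ᶻ-difference a b)))) }
    ; 0-homo = refl
    ; 1-homo = refl
    }
    where
    +-homo : ∀ x y → ⟦ RawRing._+_ ℤ-rawRing x y ⟧ᶻ ≈ ⟦ x ⟧ᶻ + ⟦ y ⟧ᶻ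
    +-homo (a , b) (c , d) = begin
      ⟦ normalise (a ℕ.+ c) (b ℕ.+ d) ⟧ᶻ   ≈⟨ normalise-sound (a ℕ.+ c) (b ℕ.+ d) ⟩
      ι (a ℕ.+ c) - ι (b ℕ.+ d)            ≈⟨ +-cong (×-homo-+ 1# a c) (-‿cong (×-homo-+ 1# b d)) ⟩
      (ι a + ι c) - (ι b + ι d)            ≈⟨ difference-sum (ι a) (ι b) (ι c) (ι d) ⟩
      (ι a - ι b) + (ι c - ι d)            ≈⟨ +-cong (⟦⟧ᶻ-difference a b) (⟦⟧ᶻ-difference c d) ⟨
      ⟦ a , b ⟧ᶻ + ⟦ c , d ⟧ᶻ              ∎
    ι-+* : ∀ a b c d → ι (a ℕ.* b ℕ.+ c ℕ.* d) ≈ ι a * ι b + ι c * ι d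
    ι-+* a b c d = trans (×-homo-+ 1# (a ℕ.* b) (c ℕ.* d)) (+-cong (×1-homo-* a b) (×1-homo-* c d))
    *-homo : ∀ x y → ⟦ RawRing._*_ ℤ-rawRing x y ⟧ᶻ ≈ ⟦ x ⟧ᶻ * ⟦ y ⟧ᶻ
    *-homo (a , b) (c , d) = begin
      ⟦ normalise (a ℕ.* c ℕ.+ b ℕ.* d) (a ℕ.* d ℕ.+ b ℕ.* c) ⟧ᶻ
        ≈⟨ normalise-sound (a ℕ.* c ℕ.+ b ℕ.* d) (a ℕ.* d ℕ.+ b ℕ.* c) ⟩
      ι (a ℕ.* c ℕ.+ b ℕ.* d) - ι (a ℕ.* d ℕ.+ b ℕ.* c)
        ≈⟨ +-cong (ι-+* a c b d) (-‿cong (ι-+* a d b c)) ⟩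
      (ι a * ι c + ι b * ι d) - (ι a * ι d + ι b * ι c)
        ≈⟨ difference-product (ι a) (ι b) (ι c) (ι d) ⟩
      (ι a - ι b) * (ι c - ι d)
        ≈⟨ *-cong (⟦⟧ᶻ-difference a b) (⟦⟧ᶻ-difference c d) ⟨
      ⟦ a , b ⟧ᶻ * ⟦ c , d ⟧ᶻ
        ∎

  _≟ᶻ_ : WeaklyDecidable (Induced-equivalence ⟦⟧ᶻ-homomorphism)
  x ≟ᶻ y with ≡-dec _≟_ _≟_ x y
  ... | yes ≡.refl = just refl
  ... | no _       = nothing

  open import Algebra.Solver.Ring ℤ-rawRing (fromCommutativeRing R) ⟦⟧ᶻ-homomorphism _≟ᶻ_ public
    using (Polynomial; solve; _:=_; _:+_; _:*_; :-_; _:-_; con)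

  :0 :1 : ∀ {k} → Polynomial k
  :0 = con (0 , 0)
  :1 = con (1 , 0)

module Divisibility {c ℓ : Level} (R : CommutativeRing c ℓ) where
  open CommutativeRing R renaming (Carrier to A)
  open Defs.Over R

  ∣-resp : ∀ {x y z} → x ∣R y → y ≈ z → x ∣R z
  ∣-resp (r , y≈xr) y≈z = r , trans (sym y≈z) y≈xr

  ∣-refl : ∀ x r → x ∣R (x * r)
  ∣-refl x r = r , refl

  ∣-of-zero : ∀ {x y} → y ≈ 0# → x ∣R y
  ∣-of-zero {x} y≈0 = 0# , trans y≈0 (sym (zeroʳ x))

  ∣-+ : ∀ {x y z} → x ∣R y → x ∣R z → x ∣R (y + z)
  ∣-+ {x} (r , y≈xr) (r′ , z≈xr′) = r + r′ , trans (+-cong y≈xr z≈xr′) (sym (distribˡ x r r′))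

  ∣-*ʳ : ∀ {x y} → x ∣R y → ∀ z → x ∣R (y * z)
  ∣-*ʳ {x} (r , y≈xr) z = r * z , trans (*-congʳ y≈xr) (*-assoc x r z)

  ∣-*ˡ : ∀ {x z} y → x ∣R z → x ∣R (y * z)
  ∣-*ˡ {x} {z} y x∣z = ∣-resp (∣-*ʳ x∣z y) (*-comm z y)

  ⇔-∣-resp : ∀ {a} {S : Set a} {x y z} → S ⇔ x ∣R y → y ≈ z → S ⇔ x ∣R z
  ⇔-∣-resp S⇔x∣y y≈z =
    mk⇔ (λ S → ∣-resp (to S⇔x∣y S) y≈z) (λ x∣z → from S⇔x∣y (∣-resp x∣z (sym y≈z)))
    where open Equivalence

  -- x ∣ y implies x a ∣ a y; its converse is cancellation, which needs a domain
  ∣-scale : ∀ {x y} a → x ∣R y → (x * a) ∣R (a * y)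
  ∣-scale {x} a (r , y≈xr) = r , trans (*-congˡ y≈xr) (trans (sym (*-assoc a x r)) (*-congʳ (*-comm a x)))

  ∣-weaken : ∀ {x w y} → (x * w) ∣R y → x ∣R y
  ∣-weaken {x} {w} (r , y≈xwr) = w * r , trans y≈xwr (*-assoc x w r)

module Matrices {c ℓ : Level} (R : CommutativeRing c ℓ) where
  open CommutativeRing R hiding (zero) renaming (Carrier to A)
  open Defs.Over R
  open IntegerCoefficientSolver R

  ≈M-isEquivalence : IsEquivalence _≈M_
  ≈M-isEquivalence = record
    { refl  = refl , refl , refl , refl
    ; sym   = λ { (e₁ , e₂ , e₃ , e₄) → sym e₁ , sym e₂ , sym e₃ , sym e₄ }
    ; trans = λ { (e₁ , e₂ , e₃ , e₄) (f₁ , f₂ , f₃ , f₄) →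
                  trans e₁ f₁ , trans e₂ f₂ , trans e₃ f₃ , trans e₄ f₄ }
    }

  M2-setoid : Setoid c ℓ
  M2-setoid = record { Carrier = M2 ; _≈_ = _≈M_ ; isEquivalence = ≈M-isEquivalence }

  open IsEquivalence ≈M-isEquivalence public
    using () renaming (refl to ≈M-refl; sym to ≈M-sym; trans to ≈M-trans)
  module ≈M-Reasoning = Relation.Binary.Reasoning.Setoid M2-setoid

  ⊗-cong : ∀ {X X′ Y Y′} → X ≈M X′ → Y ≈M Y′ → (X ⊗ Y) ≈M (X′ ⊗ Y′)
  ⊗-cong (a , b , c , d) (e , f , g , h) =
    +-cong (*-cong a e) (*-cong b g) , +-cong (*-cong a f) (*-cong b h) ,
    +-cong (*-cong c e) (*-cong d g) , +-cong (*-cong c f) (*-cong d h)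

  ⊗-assoc : ∀ X Y Z → ((X ⊗ Y) ⊗ Z) ≈M (X ⊗ (Y ⊗ Z))
  ⊗-assoc (mat a b c d) (mat e f g h) (mat i j k l) =
    entry a b e f g h i k , entry a b e f g h j l , entry c d e f g h i k , entry c d e f g h j l
    where
    entry : ∀ x₁ x₂ y₁ y₂ y₃ y₄ z₁ z₂ →
      (x₁ * y₁ + x₂ * y₃) * z₁ + (x₁ * y₂ + x₂ * y₄) * z₂ ≈
      x₁ * (y₁ * z₁ + y₂ * z₂) + x₂ * (y₃ * z₁ + y₄ * z₂)
    entry = solve 8 (λ x₁ x₂ y₁ y₂ y₃ y₄ z₁ z₂ →
      (x₁ :* y₁ :+ x₂ :* y₃) :* z₁ :+ (x₁ :* y₂ :+ x₂ :* y₄) :* z₂ :=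
      x₁ :* (y₁ :* z₁ :+ y₂ :* z₂) :+ x₂ :* (y₃ :* z₁ :+ y₄ :* z₂)) refl

  ⊗-identityˡ : ∀ X → (I2 ⊗ X) ≈M X
  ⊗-identityˡ (mat a b c d) = first a c , first b d , second a c , second b d
    where
    first : ∀ x y → 1# * x + 0# * y ≈ x
    first = solve 2 (λ x y → :1 :* x :+ :0 :* y := x) refl
    second : ∀ x y → 0# * x + 1# * y ≈ y
    second = solve 2 (λ x y → :0 :* x :+ :1 :* y := y) refl

  ⊗-identityʳ : ∀ X → (X ⊗ I2) ≈M X
  ⊗-identityʳ (mat a b c d) = first a b , second a b , first c d , second c d
    where
    first : ∀ x y → x * 1# + y * 0# ≈ x
    first = solve 2 (λ x y → x :* :1 :+ y :* :0 := x) refl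
    second : ∀ x y → x * 0# + y * 1# ≈ y
    second = solve 2 (λ x y → x :* :0 :+ y :* :1 := y) refl

  infixr 7 _·_
  _·_ : A → M2 → M2
  u · X = mat (u * m11 X) (u * m12 X) (u * m21 X) (u * m22 X)

  ·-cong : ∀ {u v X Y} → u ≈ v → X ≈M Y → (u · X) ≈M (v · Y)
  ·-cong u≈v (a , b , c , d) = *-cong u≈v a , *-cong u≈v b , *-cong u≈v c , *-cong u≈v d

  ·-assoc : ∀ u v X → (u · v · X) ≈M ((u * v) · X)
  ·-assoc u v X = sym (*-assoc u v _) , sym (*-assoc u v _) , sym (*-assoc u v _) , sym (*-assoc u v _)

  ·-identity : ∀ X → (1# · X) ≈M X
  ·-identity X = *-identityˡ _ , *-identityˡ _ , *-identityˡ _ , *-identityˡ _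

  ⊗-scalar : ∀ X u → (X ⊗ (u · I2)) ≈M (u · X)
  ⊗-scalar (mat a b c d) u = first u a b , second u a b , first u c d , second u c d
    where
    first : ∀ u x y → x * (u * 1#) + y * (u * 0#) ≈ u * x
    first = solve 3 (λ u x y → x :* (u :* :1) :+ y :* (u :* :0) := u :* x) refl
    second : ∀ u x y → x * (u * 0#) + y * (u * 1#) ≈ u * y
    second = solve 3 (λ u x y → x :* (u :* :0) :+ y :* (u :* :1) := u :* y) refl

  adj : M2 → M2
  adj X = mat (m22 X) (- m12 X) (- m21 X) (m11 X)

  ⊗-adj : ∀ X → (X ⊗ adj X) ≈M (nrd X · I2)
  ⊗-adj (mat a b c d) =
    solve 4 (λ a b c d → a :* d :+ b :* (:- c) := (a :* d :- b :* c) :* :1) refl a b c d ,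
    solve 4 (λ a b c d → a :* (:- b) :+ b :* a := (a :* d :- b :* c) :* :0) refl a b c d ,
    solve 4 (λ a b c d → c :* d :+ d :* (:- c) := (a :* d :- b :* c) :* :0) refl a b c d ,
    solve 4 (λ a b c d → c :* (:- b) :+ d :* a := (a :* d :- b :* c) :* :1) refl a b c d

  nrd-cong : ∀ {X Y} → X ≈M Y → nrd X ≈ nrd Y
  nrd-cong (a , b , c , d) = +-cong (*-cong a d) (-‿cong (*-cong b c))

  nrd-I2 : nrd I2 ≈ 1#
  nrd-I2 = solve 0 (:1 :* :1 :- :0 :* :0 := :1) refl

  nrd-⊗ : ∀ X Y → nrd (X ⊗ Y) ≈ nrd X * nrd Y
  nrd-⊗ (mat a b c d) (mat e f g h) =
    solve 8 (λ a b c d e f g h →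
      (a :* e :+ b :* g) :* (c :* f :+ d :* h) :- (a :* f :+ b :* h) :* (c :* e :+ d :* g) :=
      (a :* d :- b :* c) :* (e :* h :- f :* g)) refl a b c d e f g h

  left-inverse-adj : ∀ {X Y} → (Y ⊗ X) ≈M I2 → Y ≈M (nrd Y · adj X)
  left-inverse-adj {X} {Y} YX≈I = begin
    Y                              ≈⟨ ·-identity Y ⟨
    1# · Y                         ≈⟨ ·-cong (trans (sym nrd-I2) (nrd-cong (≈M-sym YX≈I))) ≈M-refl ⟩
    nrd (Y ⊗ X) · Y                ≈⟨ ·-cong (nrd-⊗ Y X) ≈M-refl ⟩
    (nrd Y * nrd X) · Y            ≈⟨ ·-assoc (nrd Y) (nrd X) Y ⟨
    nrd Y · nrd X · Y              ≈⟨ ·-cong refl (⊗-scalar Y (nrd X)) ⟨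
    nrd Y · (Y ⊗ (nrd X · I2))     ≈⟨ ·-cong refl (⊗-cong ≈M-refl (⊗-adj X)) ⟨
    nrd Y · (Y ⊗ (X ⊗ adj X))      ≈⟨ ·-cong refl (⊗-assoc Y X (adj X)) ⟨
    nrd Y · ((Y ⊗ X) ⊗ adj X)      ≈⟨ ·-cong refl (⊗-cong YX≈I ≈M-refl) ⟩
    nrd Y · (I2 ⊗ adj X)           ≈⟨ ·-cong refl (⊗-identityˡ (adj X)) ⟩
    nrd Y · adj X                  ∎
    where open ≈M-Reasoning

  lin : A → A → M2 → M2
  lin T U X = mat (T * m11 X + U) (T * m12 X) (T * m21 X) (T * m22 X + U)

  -- Cayley–Hamilton X ⊗ X = trd X · X − nrd X · I₂, in the form (T X + U) X = T′ X + U′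
  lin-⊗ : ∀ T U X → (lin T U X ⊗ X) ≈M lin (T * trd X + U) (- (T * nrd X)) X
  lin-⊗ T U (mat a b c d) =
    solve 6 (λ T U a b c d → (T :* a :+ U) :* a :+ (T :* b) :* c :=
                             (T :* (a :+ d) :+ U) :* a :+ :- (T :* (a :* d :- b :* c))) refl T U a b c d ,
    solve 6 (λ T U a b c d → (T :* a :+ U) :* b :+ (T :* b) :* d :=
                             (T :* (a :+ d) :+ U) :* b) refl T U a b c d ,
    solve 6 (λ T U a b c d → (T :* c) :* a :+ (T :* d :+ U) :* c :=
                             (T :* (a :+ d) :+ U) :* c) refl T U a b c d ,
    solve 6 (λ T U a b c d → (T :* c) :* b :+ (T :* d :+ U) :* d :=
                             (T :* (a :+ d) :+ U) :* d :+ :- (T :* (a :* d :- b :* c))) refl T U a b c d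

  chCoefficients : M2 → ℕ → A × A
  chCoefficients X zero    = 0# , 1#
  chCoefficients X (suc j) = proj₁ TU * trd X + proj₂ TU , - (proj₁ TU * nrd X)
    where
    TU : A × A
    TU = chCoefficients X j

  powers-linear : ∀ X j → mpow X j ≈M lin (proj₁ (chCoefficients X j)) (proj₂ (chCoefficients X j)) X
  powers-linear X zero =
    solve 1 (λ x → :1 := :0 :* x :+ :1) refl (m11 X) , solve 1 (λ x → :0 := :0 :* x) refl (m12 X) ,
    solve 1 (λ x → :0 := :0 :* x) refl (m21 X) , solve 1 (λ x → :1 := :0 :* x :+ :1) refl (m22 X)
  powers-linear X (suc j) = ≈M-trans (⊗-cong (powers-linear X j) ≈M-refl) (lin-⊗ _ _ X)

Least : ∀ {a} → (ℕ → Set a) → ℕ → Set a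
Least P l = 1 ≤ l × P l × (∀ j → 1 ≤ j → j < l → ¬ P j)

least-unique : ∀ {a} {P : ℕ → Set a} {l₁ l₂} → Least P l₁ → Least P l₂ → l₁ ≡ l₂
least-unique {l₁ = l₁} {l₂} (1≤l₁ , P-l₁ , below-l₁) (1≤l₂ , P-l₂ , below-l₂) with <-cmp l₁ l₂
... | tri< l₁<l₂ _ _ = ⊥-elim (below-l₂ l₁ 1≤l₁ l₁<l₂ P-l₁)
... | tri≈ _ l₁≡l₂ _ = l₁≡l₂
... | tri> _ _ l₂<l₁ = ⊥-elim (below-l₁ l₂ 1≤l₂ l₂<l₁ P-l₂)

module PrimeUniformiser {c ℓ : Level} (R : CommutativeRing c ℓ) where
  open CommutativeRing R hiding (zero) renaming (Carrier to A)
  open Defs.Over R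
  open IntegerCoefficientSolver R
  open Divisibility R
  open import Relation.Binary.Reasoning.Setoid setoid

  module _ {p : A} (dvr : IsDVR p) where
    open IsDVR dvr

    -- x = u pᵏ with u a unit, and k = 0 because p ∤ x
    nondivisible-unit : ∀ {x} → ¬ p ∣R x → IsUnit x
    nondivisible-unit {x} p∤x with factorise x (λ x≈0 → p∤x (∣-of-zero x≈0))
    ... | u , zero , (v , uv≈1) , x≈u1 = v , (begin
      x * v          ≈⟨ *-congʳ (trans x≈u1 (*-identityʳ u)) ⟩
      u * v          ≈⟨ uv≈1 ⟩
      1#             ∎)
    ... | u , suc k , _ , x≈upᵏ⁺¹ = ⊥-elim (p∤x (∣-resp (∣-refl p (u * pow p k))
      (sym (trans x≈upᵏ⁺¹ (solve 3 (λ u p q → u :* (p :* q) := p :* (u :* q)) refl u p (pow p k))))))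

    -- p is prime: x, y ∉ 𝔭 are units, so x y is a unit, while p is not
    p-prime : ∀ {x y} → ¬ p ∣R x → ¬ p ∣R y → ¬ p ∣R (x * y)
    p-prime {x} {y} p∤x p∤y (r , xy≈pr) with nondivisible-unit p∤x | nondivisible-unit p∤y
    ... | v , xv≈1 | w , yw≈1 = p-nonunit (r * (v * w) , (begin
      p * (r * (v * w))   ≈⟨ *-assoc p r (v * w) ⟨
      (p * r) * (v * w)   ≈⟨ *-congʳ xy≈pr ⟨
      (x * y) * (v * w)   ≈⟨ solve 4 (λ x y v w → (x :* y) :* (v :* w) := (x :* v) :* (y :* w)) refl x y v w ⟩
      (x * v) * (y * w)   ≈⟨ *-cong xv≈1 yw≈1 ⟩
      1# * 1#             ≈⟨ *-identityˡ 1# ⟩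
      1#                  ∎))

    -- R is a domain: a z ∈ x a R with a ≠ 0 gives z ∈ x R
    ∣-cancel : ∀ {x z} a → ¬ (a ≈ 0#) → (x * a) ∣R (a * z) → x ∣R z
    ∣-cancel {x} {z} a a≉0 (r , az≈xar) with noZeroDiv a (z - x * r) a[z-xr]≈0
      where
      a[z-xr]≈0 : a * (z - x * r) ≈ 0#
      a[z-xr]≈0 = begin
        a * (z - x * r)             ≈⟨ solve 4 (λ a x z r → a :* (z :- x :* r) := a :* z :- (x :* a) :* r)
                                             refl a x z r ⟩
        a * z - (x * a) * r         ≈⟨ +-congʳ az≈xar ⟩
        (x * a) * r - (x * a) * r   ≈⟨ -‿inverseʳ _ ⟩
        0#                          ∎
    ... | inj₁ a≈0    = ⊥-elim (a≉0 a≈0)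
    ... | inj₂ z-xr≈0 = r , (begin
      z                     ≈⟨ solve 3 (λ z x r → z := (z :- x :* r) :+ x :* r) refl z x r ⟩
      (z - x * r) + x * r   ≈⟨ +-congʳ z-xr≈0 ⟩
      0# + x * r            ≈⟨ +-identityˡ (x * r) ⟩
      x * r                 ∎)

    -- Ret j holds exactly when p ∣ Tⱼ Y; a first occurrence l > 1 forces p ∤ Y
    -- (no occurrence at 1), hence l is also the first index with p ∣ Tⱼ.
    first-occurrence : ∀ {a} {Ret : ℕ → Set a} {T : ℕ → A} {Y : A} {l} →
      (∀ j → Ret j ⇔ p ∣R (T j * Y)) → 1 < l → Least Ret l → Least (λ j → ¬ ¬ p ∣R T j) l
    first-occurrence {T = T} {Y} {l} criterion 1<l (1≤l , Ret-l , below-l) = 1≤l , p∣T-l , below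
      where
      open Equivalence
      p∤Y : ¬ p ∣R Y
      p∤Y p∣Y = below-l 1 ≤-refl 1<l (from (criterion 1) (∣-*ˡ (T 1) p∣Y))
      p∣T-l : ¬ ¬ p ∣R T l
      p∣T-l p∤T = p-prime p∤T p∤Y (to (criterion l) Ret-l)
      below : ∀ j → 1 ≤ j → j < l → ¬ ¬ ¬ p ∣R T j
      below j 1≤j j<l p∤∤T = p∤∤T (λ p∣T → below-l j 1≤j j<l (from (criterion j) (∣-*ʳ p∣T Y)))

module EichlerOrder {c ℓ : Level} (R : CommutativeRing c ℓ) (p : CommutativeRing.Carrier R) (m : ℕ) where
  open CommutativeRing R hiding (zero) renaming (Carrier to A)
  open Defs.Over R
  open IntegerCoefficientSolver R
  open Divisibility R
  open Matrices R
  module ≈-Reasoning = Relation.Binary.Reasoning.Setoid setoid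

  n : ℕ
  n = suc m

  -- P = pⁿ = p · pᵐ (definitionally)
  pm P : A
  pm = pow p m
  P  = pow p n

  𝒪 : M2 → Set (c ⊔ ℓ)
  𝒪 = InO p n

  𝒪-I2 : 𝒪 I2
  𝒪-I2 = ∣-of-zero refl

  𝒪-⊗ : ∀ X Y → 𝒪 X → 𝒪 Y → 𝒪 (X ⊗ Y)
  𝒪-⊗ X Y X∈𝒪 Y∈𝒪 = ∣-+ (∣-*ʳ X∈𝒪 (m11 Y)) (∣-*ˡ (m22 X) Y∈𝒪)

  -- since n ≥ 1, the lower left entry of an element of 𝒪 lies in 𝔭
  𝒪-p∣ : ∀ X → 𝒪 X → p ∣R m21 X
  𝒪-p∣ X = ∣-weaken

  HasLeftInverse : M2 → Set (c ⊔ ℓ)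
  HasLeftInverse M = Σ M2 λ M′ → 𝒪 M′ × (M′ ⊗ M) ≈M I2

  leftInverse-⊗ : ∀ {X Y} → HasLeftInverse X → HasLeftInverse Y → HasLeftInverse (X ⊗ Y)
  leftInverse-⊗ {X} {Y} (X′ , X′∈𝒪 , X′X≈I) (Y′ , Y′∈𝒪 , Y′Y≈I) =
    Y′ ⊗ X′ , 𝒪-⊗ Y′ X′ Y′∈𝒪 X′∈𝒪 , (begin
    (Y′ ⊗ X′) ⊗ (X ⊗ Y)     ≈⟨ ⊗-assoc Y′ X′ (X ⊗ Y) ⟩
    Y′ ⊗ (X′ ⊗ (X ⊗ Y))     ≈⟨ ⊗-cong ≈M-refl (⊗-assoc X′ X Y) ⟨
    Y′ ⊗ ((X′ ⊗ X) ⊗ Y)     ≈⟨ ⊗-cong ≈M-refl (⊗-cong X′X≈I ≈M-refl) ⟩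
    Y′ ⊗ (I2 ⊗ Y)           ≈⟨ ⊗-cong ≈M-refl (⊗-identityˡ Y) ⟩
    Y′ ⊗ Y                  ≈⟨ Y′Y≈I ⟩
    I2                      ∎)
    where open ≈M-Reasoning

  powers-𝒪 : ∀ X → 𝒪 X → ∀ j → 𝒪 (mpow X j)
  powers-𝒪 X X∈𝒪 zero    = 𝒪-I2
  powers-𝒪 X X∈𝒪 (suc j) = 𝒪-⊗ (mpow X j) X (powers-𝒪 X X∈𝒪 j) X∈𝒪

  powers-leftInverse : ∀ {X} → HasLeftInverse X → ∀ j → HasLeftInverse (mpow X j)
  powers-leftInverse X⁻¹ zero    = I2 , 𝒪-I2 , ⊗-identityˡ I2
  powers-leftInverse X⁻¹ (suc j) = leftInverse-⊗ (powers-leftInverse X⁻¹ j) X⁻¹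

  -- X M = y X with y ∈ 𝒪; then 𝒪XM ⊆ 𝒪X
  Stabilises : M2 → M2 → Set (c ⊔ ℓ)
  Stabilises X M = Σ M2 λ y → 𝒪 y × (X ⊗ M) ≈M (y ⊗ X)

  coset-⊆ : ∀ {X X′ y Z} → 𝒪 y → X ≈M (y ⊗ X′) → InCoset p n X Z → InCoset p n X′ Z
  coset-⊆ {X′ = X′} {y} y∈𝒪 X≈yX′ (x , x∈𝒪 , Z≈xX) =
    x ⊗ y , 𝒪-⊗ x y x∈𝒪 y∈𝒪 ,
    ≈M-trans Z≈xX (≈M-trans (⊗-cong ≈M-refl X≈yX′) (≈M-sym (⊗-assoc x y X′)))

  sameCoset-intro : ∀ {X M M′} → Stabilises X M → Stabilises X M′ → (M′ ⊗ M) ≈M I2 →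
                    SameCoset p n (X ⊗ M) X
  sameCoset-intro {X} {M} {M′} (y , y∈𝒪 , XM≈yX) (y′ , y′∈𝒪 , XM′≈y′X) M′M≈I Z =
    coset-⊆ y∈𝒪 XM≈yX , coset-⊆ y′∈𝒪 X≈y′XM
    where
    open ≈M-Reasoning
    X≈y′XM : X ≈M (y′ ⊗ (X ⊗ M))
    X≈y′XM = begin
      X                  ≈⟨ ⊗-identityʳ X ⟨
      X ⊗ I2             ≈⟨ ⊗-cong ≈M-refl M′M≈I ⟨
      X ⊗ (M′ ⊗ M)       ≈⟨ ⊗-assoc X M′ M ⟨
      (X ⊗ M′) ⊗ M       ≈⟨ ⊗-cong XM′≈y′X ≈M-refl ⟩
      (y′ ⊗ X) ⊗ M       ≈⟨ ⊗-assoc y′ X M ⟩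
      y′ ⊗ (X ⊗ M)       ∎

  -- XM lies in 𝒪XM, so in 𝒪X when the cosets agree
  sameCoset-elim : ∀ {X M} → SameCoset p n (X ⊗ M) X → Stabilises X M
  sameCoset-elim {X} {M} same = proj₁ (same (X ⊗ M)) (I2 , 𝒪-I2 , ≈M-sym (⊗-identityˡ (X ⊗ M)))

  module ReturnCriterion (X : M2) (d : A) (Q : M2 → A)
    (Q-cong     : ∀ {M N} → M ≈M N → Q M ≈ Q N)
    (Q-adj      : ∀ u M → Q (u · adj M) ≈ - u * Q M)
    (sufficient : ∀ {M} → 𝒪 M → d ∣R Q M → Stabilises X M)
    (necessary  : ∀ {M} → 𝒪 M → Stabilises X M → d ∣R Q M) where

    -- left inverses are scaled adjugates, so they inherit the criterion
    criterion-inverse : ∀ {M M′} → (M′ ⊗ M) ≈M I2 → d ∣R Q M → d ∣R Q M′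
    criterion-inverse {M} {M′} M′M≈I d∣QM = ∣-resp (∣-*ˡ (- nrd M′) d∣QM)
      (sym (trans (Q-cong (left-inverse-adj M′M≈I)) (Q-adj (nrd M′) M)))

    returns⇔ : ∀ {M} → 𝒪 M → HasLeftInverse M → SameCoset p n (X ⊗ M) X ⇔ d ∣R Q M
    returns⇔ M∈𝒪 (M′ , M′∈𝒪 , M′M≈I) = mk⇔
      (λ same → necessary M∈𝒪 (sameCoset-elim same))
      (λ d∣QM → sameCoset-intro (sufficient M∈𝒪 d∣QM)
                                (sufficient M′∈𝒪 (criterion-inverse M′M≈I d∣QM)) M′M≈I)

  -- 𝒪αₛM = 𝒪αₛ  ⇔  p ∣ B + s(D − A)   for M = (A B ; C D)
  αQuantity : A → M2 → A
  αQuantity s M = m12 M + s * (m22 M - m11 M)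

  αQuantity-cong : ∀ {s M N} → M ≈M N → αQuantity s M ≈ αQuantity s N
  αQuantity-cong (e₁₁ , e₁₂ , _ , e₂₂) = +-cong e₁₂ (*-congˡ (+-cong e₂₂ (-‿cong e₁₁)))

  αQuantity-adj : ∀ s u M → αQuantity s (u · adj M) ≈ - u * αQuantity s M
  αQuantity-adj s u (mat a b c d) =
    solve 5 (λ s u a b d → u :* (:- b) :+ s :* (u :* a :- u :* d) := (:- u) :* (b :+ s :* (d :- a)))
      refl s u a b d

  αQuantity-lin : ∀ s T U X → αQuantity s (lin T U X) ≈ T * αQuantity s X
  αQuantity-lin s T U (mat a b c d) =
    solve 6 (λ s T U a b d → T :* b :+ s :* ((T :* d :+ U) :- (T :* a :+ U)) := T :* (b :+ s :* (d :- a)))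
      refl s T U a b d

  -- with C = pⁿ k and B + s(D − A) = p r, the matrix y = αₛ M αₛ⁻¹ lies in 𝒪
  α-sufficient : ∀ {s M} → 𝒪 M → p ∣R αQuantity s M → Stabilises (alpha p s) M
  α-sufficient {s} {mat A B C D} (k , C≈Pk) (r , q≈pr) =
    mat (A + s * C) (r - s * s * (pm * k)) (p * C) (D - s * C) , ∣-*ˡ p (k , C≈Pk) ,
    solve 5 (λ A C s r c₁ → :1 :* A :+ s :* C := (A :+ s :* C) :* :1 :+ (r :- s :* s :* c₁) :* :0)
      refl A C s r (pm * k) ,
    e₁₂ ,
    solve 5 (λ A C D p s → :0 :* A :+ p :* C := (p :* C) :* :1 :+ (D :- s :* C) :* :0) refl A C D p s ,
    solve 5 (λ B C D p s → :0 :* B :+ p :* D := (p :* C) :* s :+ (D :- s :* C) :* p) refl B C D p s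
    where
    open ≈-Reasoning
    C≈pc₁ : C ≈ p * (pm * k)
    C≈pc₁ = trans C≈Pk (*-assoc p pm k)
    e₁₂ : 1# * B + s * D ≈ (A + s * C) * s + (r - s * s * (pm * k)) * p
    e₁₂ = begin
      1# * B + s * D
        ≈⟨ solve 4 (λ A B D s → :1 :* B :+ s :* D := (B :+ s :* (D :- A)) :+ s :* A) refl A B D s ⟩
      (B + s * (D - A)) + s * A
        ≈⟨ +-congʳ q≈pr ⟩
      p * r + s * A
        ≈⟨ solve 5 (λ A s r c₁ p → p :* r :+ s :* A := (A :+ s :* (p :* c₁)) :* s :+ (r :- s :* s :* c₁) :* p)
             refl A s r (pm * k) p ⟩
      (A + s * (p * (pm * k))) * s + (r - s * s * (pm * k)) * p
        ≈⟨ +-congʳ (*-congʳ (+-congˡ (*-congˡ C≈pc₁))) ⟨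
      (A + s * C) * s + (r - s * s * (pm * k)) * p
        ∎

  -- from αₛ M = y αₛ: B + s(D − A) = p y₁₂ + s² C, and p ∣ C
  α-necessary : ∀ {s M} → 𝒪 M → Stabilises (alpha p s) M → p ∣R αQuantity s M
  α-necessary {s} {mat A B C D} M∈𝒪 (mat y₁ y₂ y₃ y₄ , _ , e₁₁ , e₁₂ , _ , _) =
    ∣-resp (∣-+ (∣-refl p y₂) (∣-*ʳ (𝒪-p∣ (mat A B C D) M∈𝒪) (s * s))) (begin
      p * y₂ + C * (s * s)
        ≈⟨ solve 6 (λ y₁ y₂ p s C t →
                      p :* y₂ :+ C :* t := (y₁ :* s :+ y₂ :* p) :- s :* (y₁ :* :1 :+ y₂ :* :0) :+ C :* t)
             refl y₁ y₂ p s C (s * s) ⟩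
      (y₁ * s + y₂ * p) - s * (y₁ * 1# + y₂ * 0#) + C * (s * s)
        ≈⟨ +-congʳ (+-cong e₁₂ (-‿cong (*-congˡ e₁₁))) ⟨
      (1# * B + s * D) - s * (1# * A + s * C) + C * (s * s)
        ≈⟨ solve 5 (λ A B C D s →
                      (:1 :* B :+ s :* D) :- s :* (:1 :* A :+ s :* C) :+ C :* (s :* s) := B :+ s :* (D :- A))
             refl A B C D s ⟩
      B + s * (D - A)
        ∎)
    where open ≈-Reasoning

  -- 𝒪βₛM = 𝒪βₛ  ⇔  p pⁿ ∣ C + s pⁿ (A − D)   for M = (A B ; C D)
  βQuantity : A → M2 → A
  βQuantity s M = m21 M + (s * P) * (m11 M - m22 M)

  βQuantity-cong : ∀ {s M N} → M ≈M N → βQuantity s M ≈ βQuantity s N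
  βQuantity-cong (e₁₁ , _ , e₂₁ , e₂₂) = +-cong e₂₁ (*-congˡ (+-cong e₁₁ (-‿cong e₂₂)))

  βQuantity-adj : ∀ s u M → βQuantity s (u · adj M) ≈ - u * βQuantity s M
  βQuantity-adj s u (mat a b c d) =
    solve 5 (λ t u a c d → u :* (:- c) :+ t :* (u :* d :- u :* a) := (:- u) :* (c :+ t :* (a :- d)))
      refl (s * P) u a c d

  βQuantity-lin : ∀ s T U X → βQuantity s (lin T U X) ≈ T * βQuantity s X
  βQuantity-lin s T U (mat a b c d) =
    solve 6 (λ t T U a c d → T :* c :+ t :* ((T :* a :+ U) :- (T :* d :+ U)) := T :* (c :+ t :* (a :- d)))
      refl (s * P) T U a c d

  -- with C + s pⁿ(A − D) = p pⁿ r, an explicit y = βₛ M βₛ⁻¹ ∈ 𝒪 (its lower left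
  -- entry pⁿ(r − s² pᵐ B) is where n ≥ 1 is used)
  β-sufficient : ∀ {s M} → (p * P) ∣R βQuantity s M → Stabilises (alphaConj p n s) M
  β-sufficient {s} {mat A B C D} (r , q≈pPr) =
    mat (A - (s * P) * B) (p * B) (P * (r - s * s * (pm * B))) ((s * P) * B + D) , ∣-refl P _ ,
    solve 5 (λ p t A B C → p :* A :+ :0 :* C := (A :- t :* B) :* p :+ (p :* B) :* t) refl p (s * P) A B C ,
    solve 5 (λ p t A B D → p :* B :+ :0 :* D := (A :- t :* B) :* :0 :+ (p :* B) :* :1) refl p (s * P) A B D ,
    e₂₁ ,
    solve 4 (λ t B D y → t :* B :+ :1 :* D := y :* :0 :+ (t :* B :+ D) :* :1)
      refl (s * P) B D (P * (r - s * s * (pm * B)))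
    where
    open ≈-Reasoning
    e₂₁ : (s * P) * A + 1# * C ≈ (P * (r - s * s * (pm * B))) * p + ((s * P) * B + D) * (s * P)
    e₂₁ = begin
      (s * P) * A + 1# * C
        ≈⟨ solve 4 (λ t A C D → t :* A :+ :1 :* C := (C :+ t :* (A :- D)) :+ t :* D) refl (s * P) A C D ⟩
      (C + (s * P) * (A - D)) + (s * P) * D
        ≈⟨ +-congʳ q≈pPr ⟩
      (p * P) * r + (s * P) * D
        ≈⟨ solve 6 (λ p pm s r B D → (p :* (p :* pm)) :* r :+ (s :* (p :* pm)) :* D :=
                      ((p :* pm) :* (r :- s :* s :* (pm :* B))) :* p :+ ((s :* (p :* pm)) :* B :+ D) :* (s :* (p :* pm)))
             refl p pm s r B D ⟩
      (P * (r - s * s * (pm * B))) * p + ((s * P) * B + D) * (s * P)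
        ∎

  -- from βₛ M = y βₛ with y₂₁ = pⁿ k: C + s pⁿ(A − D) = p pⁿ (k + s² pᵐ B)
  β-necessary : ∀ {s M} → Stabilises (alphaConj p n s) M → (p * P) ∣R βQuantity s M
  β-necessary {s} {mat A B C D} (mat y₁ y₂ y₃ y₄ , (k , y₃≈Pk) , _ , _ , e₂₁ , e₂₂) =
    k + s * s * (pm * B) , (begin
      C + (s * P) * (A - D)
        ≈⟨ solve 5 (λ t A B C D →
                      C :+ t :* (A :- D) := (t :* A :+ :1 :* C) :- t :* (t :* B :+ :1 :* D) :+ t :* (t :* B))
             refl (s * P) A B C D ⟩
      ((s * P) * A + 1# * C) - (s * P) * ((s * P) * B + 1# * D) + (s * P) * ((s * P) * B)
        ≈⟨ +-congʳ (+-cong e₂₁ (-‿cong (*-congˡ e₂₂))) ⟩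
      (y₃ * p + y₄ * (s * P)) - (s * P) * (y₃ * 0# + y₄ * 1#) + (s * P) * ((s * P) * B)
        ≈⟨ solve 5 (λ t y₃ y₄ p v →
                      (y₃ :* p :+ y₄ :* t) :- t :* (y₃ :* :0 :+ y₄ :* :1) :+ v := y₃ :* p :+ v)
             refl (s * P) y₃ y₄ p ((s * P) * ((s * P) * B)) ⟩
      y₃ * p + (s * P) * ((s * P) * B)
        ≈⟨ +-congʳ (*-congʳ y₃≈Pk) ⟩
      (P * k) * p + (s * P) * ((s * P) * B)
        ≈⟨ solve 5 (λ p pm k s B → ((p :* pm) :* k) :* p :+ (s :* (p :* pm)) :* ((s :* (p :* pm)) :* B) :=
                      (p :* (p :* pm)) :* (k :+ s :* s :* (pm :* B)))
             refl p pm k s B ⟩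
      (p * P) * (k + s * s * (pm * B))
        ∎)
    where open ≈-Reasoning

  module αCriterion (s : A) =
    ReturnCriterion (alpha p s) p (αQuantity s) αQuantity-cong (αQuantity-adj s) α-sufficient α-necessary
  module βCriterion (s : A) =
    ReturnCriterion (alphaConj p n s) (p * P) (βQuantity s) βQuantity-cong (βQuantity-adj s)
      (λ _ → β-sufficient) (λ _ → β-necessary)

  module Orbits (dvr : IsDVR p) (ω : M2) (ω∈𝒪 : 𝒪 ω) (ω⁻¹ : HasLeftInverse ω) where
    open PrimeUniformiser R using (first-occurrence; ∣-cancel)
    open Equivalence

    -- ωʲ = Tⱼ ω + Uⱼ I₂
    T : ℕ → A
    T j = proj₁ (chCoefficients ω j)

    Returns : M2 → ℕ → Set (c ⊔ ℓ)
    Returns X j = SameCoset p n (X ⊗ mpow ω j) X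

    -- the fixed factors b + s(d − a) and c₀ + s(a − d), where ω = (a b ; pⁿc₀ d)
    αFactor βFactor : A → A
    αFactor s = αQuantity s ω
    βFactor s = proj₁ ω∈𝒪 + s * (m11 ω - m22 ω)

    α-returns⇔ : ∀ s j → Returns (alpha p s) j ⇔ p ∣R (T j * αFactor s)
    α-returns⇔ s j = ⇔-∣-resp (αCriterion.returns⇔ s (powers-𝒪 ω ω∈𝒪 j) (powers-leftInverse ω⁻¹ j))
      (trans (αQuantity-cong (powers-linear ω j)) (αQuantity-lin s _ _ ω))

    βQuantity-power : ∀ s j → βQuantity s (mpow ω j) ≈ P * (T j * βFactor s)
    βQuantity-power s j = begin
      βQuantity s (mpow ω j)
        ≈⟨ βQuantity-cong (powers-linear ω j) ⟩
      βQuantity s (lin (T j) _ ω)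
        ≈⟨ βQuantity-lin s _ _ ω ⟩
      T j * (m21 ω + (s * P) * (m11 ω - m22 ω))
        ≈⟨ *-congˡ (+-congʳ (proj₂ ω∈𝒪)) ⟩
      T j * (P * c₀ + (s * P) * (m11 ω - m22 ω))
        ≈⟨ solve 5 (λ t P c₀ s e → t :* (P :* c₀ :+ (s :* P) :* e) := P :* (t :* (c₀ :+ s :* e)))
             refl (T j) P c₀ s (m11 ω - m22 ω) ⟩
      P * (T j * βFactor s)
        ∎
      where
      open ≈-Reasoning
      c₀ : A
      c₀ = proj₁ ω∈𝒪

    β-returns : ∀ s j → Returns (alphaConj p n s) j ⇔ (p * P) ∣R (P * (T j * βFactor s))
    β-returns s j = ⇔-∣-resp (βCriterion.returns⇔ s (powers-𝒪 ω ω∈𝒪 j) (powers-leftInverse ω⁻¹ j))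
      (βQuantity-power s j)

    -- if pⁿ = 0, every coset 𝒪βₛ is fixed by σ_ω
    P-nonzero : ∀ s → ¬ Returns (alphaConj p n s) 1 → ¬ (P ≈ 0#)
    P-nonzero s ¬fixed P≈0 = ¬fixed (from (β-returns s 1) (∣-of-zero (trans (*-congʳ P≈0) (zeroˡ _))))

    β-returns⇔ : ¬ (P ≈ 0#) → ∀ s j → Returns (alphaConj p n s) j ⇔ p ∣R (T j * βFactor s)
    β-returns⇔ P≉0 s j = mk⇔ (λ fixed → ∣-cancel dvr P P≉0 (to (β-returns s j) fixed))
                             (λ p∣ → from (β-returns s j) (∣-scale P p∣))

    α-cycle : ∀ s {l} → 1 < l → CycleLength p n ω (alpha p s) l → Least (λ j → ¬ ¬ p ∣R T j) l
    α-cycle s 1<l cycle = first-occurrence dvr (α-returns⇔ s) 1<l cycle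

    β-cycle : ∀ s {l} → 1 < l → CycleLength p n ω (alphaConj p n s) l → Least (λ j → ¬ ¬ p ∣R T j) l
    β-cycle s 1<l cycle@(_ , _ , below-l) =
      first-occurrence dvr (β-returns⇔ (P-nonzero s (below-l 1 ≤-refl 1<l)) s) 1<l cycle

theorem5p5 : ∀ {c ℓ : Level} (R : CommutativeRing c ℓ) →
    let open CommutativeRing R renaming (Carrier to A)
        open Defs.Over R
    in (p : A) → IsDVR p → IsComplete p →
       (q : ℕ) (b : Fin q → A) → IsResidueReps p q b →
       (n : ℕ) → 1 ≤ n →
       (ω : M2) → InOUnits p n ω →
       (l₁ l₂ : ℕ) →
       CommonCycleLength p n ω q (λ s → alpha p (b s)) l₁ →
       CommonCycleLength p n ω q (λ s → alphaConj p n (b s)) l₂ →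
       (Prime q ⊎ ¬ (p ∣R (trd ω * trd ω - (1# + 1# + 1# + 1#) * nrd ω))) →
       l₁ ≡ l₂
theorem5p5 R p dvr _ q b _ (suc m) _ ω (ω∈𝒪 , ω′ , ω′∈𝒪 , _ , ω′ω≈I) l₁ l₂
           (1<l₁ , (s₁ , cycle₁) , _) (1<l₂ , (s₂ , cycle₂) , _) _ =
  least-unique (α-cycle (b s₁) 1<l₁ cycle₁) (β-cycle (b s₂) 1<l₂ cycle₂)
  where open EichlerOrder.Orbits R p m dvr ω ω∈𝒪 (ω′ , ω′∈𝒪 , ω′ω≈I)
theorem5p5 R p dvr _ q b _ zero () ω _ l₁ l₂ _ _ _
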